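{- Let $\mathcal{M}$ be a super-additive Kripke-exstit $n$-model in which $R_X$ and $R_Y$ are irreflexive, and let $w,w'\in W$ with $wR_\Box w'$. Then for every $v\in h^-[w]$ there exists $v'\in h^-[w']$ with $vR_{Ags}v'$, and for every $v'\in h^-[w']$ there exists $v\in h^-[w]$ with $vR_{Ags}v'$.
   Context: A super-additive Kripke-exstit frame is $\langle W,R_\Box,R_X,R_Y,\mathtt{Choice},\{\approx_\alpha\}_{\alpha\in Ags}\rangle$ ($Ags$ a finite set of agents) with: $R_\Box$ an equivalence relation ($\overline{w}$ its class of $w$); $R_X,R_Y$ serial and deterministic (unique successors $w^{+1},w^{ -1}$) with $(w^{+1})^{ -1}=w=(w^{ -1})^{+1}$ and (NX) if $wR_Xy$, $yR_\Box v$ then $\exists z$: $wR_\Box z$, $zR_Xv$; for each $\alpha$ an equivalence relation $R_\alpha$ and an equivalence relation $R_{Ags}$ with $R_{Ags}\subseteq R_\alpha$ for all $\alpha$; (SET) $R_\alpha\subseteq R_\Box$; (IA) for every $w$ and every choice of $R_\alpha$-classes $s(\alpha)\subseteq\overline{w}$, $\bigcap_\alpha s(\alpha)\neq\emptyset$; (NA) if $wR_\alpha v'$, $v'R_Xo'$, $o'R_\Box o$ then $\exists z$: $wR_\alpha z$, $zR_Xo$; (NAgs) if $wR_{Ags} v'$, $v'R_Xo'$, $o'R_\Box o$ then $\exists z$: $wR_{Ags} z$, $zR_Xo$; each $\approx_\alpha$ an equivalence relation with (Unif-H) and (NoF) (as usual for these frames). $n$-frame: each $\overline{w}$ contains at most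 $n$ classes of $R_{Ags}$ and of each $R_\alpha$. A model adds a valuation. Notation: $h^-[w]=\{v: wR_Y^*v\}$, where $R_Y^*$ is the transitive closure of $R_Y$ (i.e. the worlds $w^{ -1},w^{ -2},\dots$). -}

module Defs where

open import Level using (0ℓ)
open import Data.Nat using (ℕ; suc)
open import Data.Fin using (Fin)
open import Data.Product using (Σ; ∃; _×_; _,_)
open import Relation.Nullary using (¬_)
open import Relation.Binary.PropositionalEquality using (_≡_)
open import Relation.Binary using (Rel; IsEquivalence; Irreflexive)
open import Relation.Binary.Construct.Closure.Transitive using (TransClosure)

record Frame (m : ℕ) : Set₁ where
  field
    W      : Set
    R□     : Rel W 0ℓ
    RX     : Rel W 0ℓ
    RY     : Rel W 0ℓ
    Rα     : Fin m → Rel W 0ℓ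
    RAgs   : Rel W 0ℓ
    ≈α     : Fin m → Rel W 0ℓ
    R□-equiv   : IsEquivalence R□
    RX-serial  : ∀ w → ∃ λ v → RX w v
    RX-det     : ∀ {w v u} → RX w v → RX w u → v ≡ u
    RY-serial  : ∀ w → ∃ λ v → RY w v
    RY-det     : ∀ {w v u} → RY w v → RY w u → v ≡ u
    XY-inv     : ∀ {w v u} → RX w v → RY v u → u ≡ w
    YX-inv     : ∀ {w v u} → RY w v → RX v u → u ≡ w
    NX         : ∀ {w y v} → RX w y → R□ y v → ∃ λ z → R□ w z × RX z v
    Rα-equiv   : ∀ α → IsEquivalence (Rα α)
    RAgs-equiv : IsEquivalence RAgs
    RAgs⊆Rα    : ∀ α {w v} → RAgs w v → Rα α w v
    SET        : ∀ α {w v} → Rα α w v → R□ w v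
    -- (IA): every choice of one R_α-class (given by a representative s α)
    -- inside the class of w has non-empty intersection
    IA         : ∀ w (s : Fin m → W) → (∀ α → R□ w (s α)) →
                 ∃ λ z → ∀ α → Rα α (s α) z
    NA         : ∀ α {w v' o' o} → Rα α w v' → RX v' o' → R□ o' o →
                 ∃ λ z → Rα α w z × RX z o
    NAgs       : ∀ {w v' o' o} → RAgs w v' → RX v' o' → R□ o' o →
                 ∃ λ z → RAgs w z × RX z o
    -- epistemic relations (Unif-H and NoF omitted)
    ≈α-equiv   : ∀ α → IsEquivalence (≈α α)

open Frame public

-- "R has at most n classes inside each R□-class": among any n+1 worlds of
-- one R□-class, two are R-related.
AtMostClasses : ∀ {m} (F : Frame m) → ℕ → Rel (W F) 0ℓ → Set
AtMostClasses F n R =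
  ∀ w (f : Fin (suc n) → W F) → (∀ i → R□ F w (f i)) →
  Σ (Fin (suc n)) λ i → Σ (Fin (suc n)) λ j → ¬ (i ≡ j) × R (f i) (f j)

IsNFrame : ∀ {m} → ℕ → Frame m → Set
IsNFrame n F = AtMostClasses F n (RAgs F) × (∀ α → AtMostClasses F n (Rα F α))

record Model (m : ℕ) : Set₁ where
  field
    frame : Frame m
    Atom  : Set
    V     : Atom → W frame → Set

h⁻ : ∀ {m} (F : Frame m) → W F → W F → Set
h⁻ F w v = TransClosure (RY F) w v

-- Going one step into the past commutes with R□ by (NX), and with R_Ags at the
-- last step by (NAgs) applied to the reflexive pair (x, x); by symmetry of R□ and
-- R_Ags the converse inclusion follows.
module Submission where

open import Defs
open import Data.Nat using (ℕ)
open import Data.Product using (∃; _×_; _,_)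
open import Relation.Binary using (Irreflexive; IsEquivalence)
open import Relation.Binary.PropositionalEquality using (_≡_; subst)
open import Relation.Binary.Construct.Closure.Transitive using ([_]; _∷_)

module _ {m : ℕ} (F : Frame m) where
  open IsEquivalence

  RY⇒RX˘ : ∀ {w x} → RY F w x → RX F x w
  RY⇒RX˘ {x = x} p with RX-serial F x
  ... | u , q = subst (RX F x) (YX-inv F p q) q

  RX⇒RY˘ : ∀ {z w} → RX F z w → RY F w z
  RX⇒RY˘ {w = w} p with RY-serial F w
  ... | y , q = subst (RY F w) (XY-inv F p q) q

  RY-step-R□ : ∀ {w w' x} → R□ F w w' → RY F w x →
               ∃ λ z → R□ F x z × RY F w' z
  RY-step-R□ e p with NX F (RY⇒RX˘ p) e
  ... | z , b , q = z , b , RX⇒RY˘ q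

  RY-step-RAgs : ∀ {w w' x} → R□ F w w' → RY F w x →
                 ∃ λ z → RAgs F x z × RY F w' z
  RY-step-RAgs e p with NAgs F (refl (RAgs-equiv F)) (RY⇒RX˘ p) e
  ... | z , a , q = z , a , RX⇒RY˘ q

  h⁻-R□-simulation : ∀ {w w'} → R□ F w w' →
                     ∀ v → h⁻ F w v → ∃ λ v' → h⁻ F w' v' × RAgs F v v'
  h⁻-R□-simulation e v [ p ] with RY-step-RAgs e p
  ... | v' , a , q = v' , [ q ] , a
  h⁻-R□-simulation e v (p ∷ rest) with RY-step-R□ e p
  ... | z , b , q with h⁻-R□-simulation b v rest
  ... | v' , h , a = v' , q ∷ h , a

lemma3 : (m n : ℕ) (M : Model m) →
    let F = Model.frame M in
    IsNFrame n F →
    Irreflexive _≡_ (RX F) → Irreflexive _≡_ (RY F) →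
    ∀ w w' → R□ F w w' →
    (∀ v → h⁻ F w v → ∃ λ v' → h⁻ F w' v' × RAgs F v v') ×
    (∀ v' → h⁻ F w' v' → ∃ λ v → h⁻ F w v × RAgs F v v')
lemma3 m n M _ _ _ w w' e = h⁻-R□-simulation F e , backward
  where
  F = Model.frame M
  open IsEquivalence

  backward : ∀ v' → h⁻ F w' v' → ∃ λ v → h⁻ F w v × RAgs F v v'
  backward v' h with h⁻-R□-simulation F (sym (R□-equiv F) e) v' h
  ... | v , h' , a = v , h' , sym (RAgs-equiv F) a
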